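{- Let $m\ge 2$ be an integer such that a Hadamard matrix of order $m$ exists, and let $\varphi: Z_{2m}^n\to Z_2^{mn}$ be the generalized Gray map defined below. If $\mathcal C\subseteq Z_{2m}^n$ is an $(n,M,d)^*$-code, then $\varphi(\mathcal C)=\{\varphi(\bar x):\bar x\in\mathcal C\}$ is a binary $(mn,M,d)$-code.
   Context: A binary $(N,M,d)$-code is a subset of $Z_2^N$ of cardinality $M$ in which any two distinct elements are at Hamming distance at least $d$. Let $A=\{a_0,a_1,\dots,a_{2m-1}\}\subset Z_2^m$ be an $(m,2m,m/2)$-code (a Hadamard code) such that $a_0$ is the all-zero word and $a_i+a_{i+m}$ is the all-one word for every $i=0,\dots,m-1$. The generalized Gray map is $\varphi(x_1,\dots,x_n)=(a_{x_1},\dots,a_{x_n})$ (concatenation). Define $wt^*:Z_{2m}\to\mathbb R_{\ge0}$ by $wt^*(0)=0$, $wt^*(m)=m$, and $wt^*(x)=m/2$ for $x\ne 0,m$; and $d^*(\bar x,\bar y)=\sum_{i=1}^n wt^*(y_i-x_i)$ on $Z_{2m}^n$. A set $\mathcal C\subseteq Z_{2m}^n$ is an $(n,M,d)^*$-code if $|\mathcal C|=M$ and the $d^*$-distance between any two distinct elements of $\mathcal C$ is at least $d$. -}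

module Defs where

open import Data.Nat using (ℕ; zero; suc; _+_; _*_; _∸_; _≤_; _≡ᵇ_; NonZero)
open import Data.Nat.DivMod using (_%_)
open import Data.Integer as ℤ using (ℤ)
open import Data.Bool using (Bool; true; false; not; if_then_else_)
open import Data.Fin using (Fin; toℕ; _≟_)
open import Data.Vec using (Vec; []; _∷_; concat; map)
open import Relation.Binary.PropositionalEquality using (_≡_; _≢_)
open import Data.Product using (_×_)
open import Data.Sum using (_⊎_)
open import Function.Definitions using (Injective)

Σℤ : ∀ {k} → (Fin k → ℤ) → ℤ
Σℤ {zero}  f = ℤ.+ 0
Σℤ {suc k} f = f Fin.zero ℤ.+ Σℤ (λ i → f (Fin.suc i))

-- A Hadamard matrix of order m: entries ±1, H Hᵀ = m I
-- (the diagonal of H Hᵀ equals m automatically; we state it anyway)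
record IsHadamard (m : ℕ) (H : Fin m → Fin m → ℤ) : Set where
  field
    entries : ∀ i j → (H i j ≡ ℤ.+ 1) ⊎ (H i j ≡ ℤ.- (ℤ.+ 1))
    orth    : ∀ i j → i ≢ j → Σℤ (λ k → H i k ℤ.* H j k) ≡ ℤ.+ 0
    diag    : ∀ i → Σℤ (λ k → H i k ℤ.* H i k) ≡ ℤ.+ m

HadamardExists : ℕ → Set
HadamardExists m = Σ (Fin m → Fin m → ℤ) (IsHadamard m)
  where open import Data.Product using (Σ)

xor : Bool → Bool → Bool
xor true  b = not b
xor false b = b

hamming : ∀ {N} → Vec Bool N → Vec Bool N → ℕ
hamming []       []       = 0
hamming (x ∷ xs) (y ∷ ys) = (if xor x y then 1 else 0) + hamming xs ys

IsBinaryCode : (N M d : ℕ) → (Fin M → Vec Bool N) → Set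
IsBinaryCode N M d c =
  Injective _≡_ _≡_ c × (∀ i j → i ≢ j → d ≤ hamming (c i) (c j))

subMod : (m : ℕ) .{{_ : NonZero m}} → Fin (2 * m) → Fin (2 * m) → ℕ
subMod m y x = (toℕ y + (2 * m ∸ toℕ x)) % (2 * m)
  where instance
    nz2m : NonZero (2 * m)
    nz2m = Data.Nat.Properties.m*n≢0 2 m
      where import Data.Nat.Properties

-- twice the weight wt*: 2·wt*(0) = 0, 2·wt*(m) = 2m, 2·wt*(x) = m otherwise
wt2 : (m : ℕ) → ℕ → ℕ
wt2 m r = if r ≡ᵇ 0 then 0 else (if r ≡ᵇ m then 2 * m else m)

dstar2 : (m : ℕ) .{{_ : NonZero m}} → ∀ {n} → Vec (Fin (2 * m)) n → Vec (Fin (2 * m)) n → ℕ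
dstar2 m []       []       = 0
dstar2 m (x ∷ xs) (y ∷ ys) = wt2 m (subMod m y x) + dstar2 m xs ys

-- (n, M, d)*-code in Z_{2m}^n, as an indexed family of M distinct words;
-- d* ≥ d is stated as 2·d* ≥ 2·d to stay in ℕ
IsStarCode : (m : ℕ) .{{_ : NonZero m}} → (n M d : ℕ) → (Fin M → Vec (Fin (2 * m)) n) → Set
IsStarCode m n M d c =
  Injective _≡_ _≡_ c × (∀ i j → i ≢ j → 2 * d ≤ dstar2 m (c i) (c j))

record IsGrayCode (m : ℕ) (a : Fin (2 * m) → Vec Bool m) : Set where
  field
    distinct : Injective _≡_ _≡_ a
    dist     : ∀ i j → i ≢ j → m ≤ 2 * hamming (a i) (a j)
    zeroWord : ∀ (i : Fin (2 * m)) → toℕ i ≡ 0 → a i ≡ Data.Vec.replicate m false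
    compl    : ∀ (i j : Fin (2 * m)) → toℕ j ≡ toℕ i + m → a j ≡ map not (a i)

gray : ∀ {m n} → (Fin (2 * m) → Vec Bool m) → Vec (Fin (2 * m)) n → Vec Bool (n * m)
gray a xs = concat (map a xs)

-- The Gray map is coordinatewise, so it suffices to compare 2·wt*(y − x) with twice the
-- Hamming distance between a_x and a_y. If y = x the weight is 0. If y − x = m, then
-- y = x ± m, so one of a_x, a_y is the complement of the other and their distance is
-- exactly m. Otherwise x ≠ y and A has minimum distance m/2. Summing over coordinates,
-- d*(x̄, ȳ) ≤ d_H(φ(x̄), φ(ȳ)); injectivity of φ comes from that of i ↦ a_i.
module Submission where

open import Defs
open import Data.Nat using (ℕ; _≤_; _*_; NonZero)
open import Data.Fin using (Fin)
open import Data.Vec using (Vec)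
open import Data.Bool using (Bool)

open import Data.Nat using (suc; _+_; _∸_; _<_; _≡ᵇ_; z≤n)
open import Data.Nat.Properties
open import Data.Nat.DivMod using (_%_; n%n≡0; [m+n]%n≡m%n; m<n⇒m%n≡m)
open import Data.Fin using (toℕ)
open import Data.Fin.Properties using (toℕ<n)
open import Data.Vec using ([]; _∷_; _++_; map)
open import Data.Vec.Properties using (++-injective)
open import Data.Bool using (true; false; not; if_then_else_; T)
open import Data.Product using (_,_)
open import Data.Sum using (_⊎_; inj₁; inj₂; [_,_]′)
open import Function.Definitions using (Injective)
open import Relation.Binary.PropositionalEquality
open import Relation.Nullary using (yes; no)

hamming-comm : ∀ {k} (u v : Vec Bool k) → hamming u v ≡ hamming v u
hamming-comm []          []          = refl
hamming-comm (true ∷ u)  (true ∷ v)  = hamming-comm u v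
hamming-comm (true ∷ u)  (false ∷ v) = cong suc (hamming-comm u v)
hamming-comm (false ∷ u) (true ∷ v)  = cong suc (hamming-comm u v)
hamming-comm (false ∷ u) (false ∷ v) = hamming-comm u v

hamming-++ : ∀ {k l} (u u′ : Vec Bool k) (v v′ : Vec Bool l) →
             hamming (u ++ v) (u′ ++ v′) ≡ hamming u u′ + hamming v v′
hamming-++ []      []       v v′ = refl
hamming-++ (x ∷ u) (y ∷ u′) v v′ =
  trans (cong ((if xor x y then 1 else 0) +_) (hamming-++ u u′ v v′))
        (sym (+-assoc (if xor x y then 1 else 0) _ _))

hamming-not : ∀ {k} (u : Vec Bool k) → hamming u (map not u) ≡ k
hamming-not []          = refl
hamming-not (true ∷ u)  = cong suc (hamming-not u)
hamming-not (false ∷ u) = cong suc (hamming-not u)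

gray-injective : ∀ {m n} (a : Fin (2 * m) → Vec Bool m) → Injective _≡_ _≡_ a →
                 Injective _≡_ _≡_ (gray {m} {n} a)
gray-injective a a-inj {[]}     {[]}     eq = refl
gray-injective a a-inj {x ∷ xs} {y ∷ ys} eq with ++-injective (a x) (a y) eq
... | ax≡ay , rest≡ = cong₂ _∷_ (a-inj ax≡ay) (gray-injective a a-inj rest≡)

%-below-double : ∀ s n .{{_ : NonZero n}} → s < n + n → s % n ≡ s ⊎ s % n + n ≡ s
%-below-double s n s<2n with s <? n
... | yes s<n = inj₁ (m<n⇒m%n≡m s<n)
... | no s≮n = inj₂ (begin
    s % n + n             ≡⟨ cong (λ t → t % n + n) (sym s∸n+n≡s) ⟩
    (s ∸ n + n) % n + n   ≡⟨ cong (_+ n) ([m+n]%n≡m%n (s ∸ n) n) ⟩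
    (s ∸ n) % n + n       ≡⟨ cong (_+ n) (m<n⇒m%n≡m s∸n<n) ⟩
    s ∸ n + n             ≡⟨ s∸n+n≡s ⟩
    s                     ∎)
  where
    open ≡-Reasoning
    s∸n+n≡s : s ∸ n + n ≡ s
    s∸n+n≡s = m∸n+n≡m (≮⇒≥ s≮n)
    s∸n<n : s ∸ n < n
    s∸n<n = +-cancelʳ-< _ _ n (subst (_< n + n) (sym s∸n+n≡s) s<2n)

wt2-≤ : ∀ m r b → (r ≢ 0 → m ≤ b) → (r ≡ m → 2 * m ≤ b) → wt2 m r ≤ b
wt2-≤ m r b nonzero-≤ half-≤ with r ≡ᵇ 0 in r≡ᵇ0
... | true = z≤n
... | false with r ≡ᵇ m in r≡ᵇm
...   | true  = half-≤ (≡ᵇ⇒≡ r m (subst T (sym r≡ᵇm) _))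
...   | false = nonzero-≤ (λ r≡0 → subst T r≡ᵇ0 (≡⇒≡ᵇ r 0 r≡0))

module _ (m : ℕ) .{{_ : NonZero m}} where
  private instance
    2m≢0 : NonZero (2 * m)
    2m≢0 = m*n≢0 2 m

  subMod-self : ∀ x → subMod m x x ≡ 0
  subMod-self x = trans (cong (_% (2 * m)) (m+[n∸m]≡n (<⇒≤ (toℕ<n x)))) (n%n≡0 (2 * m))

  subMod≡m⇒antipodal : ∀ x y → subMod m y x ≡ m →
                       toℕ x ≡ toℕ y + m ⊎ toℕ y ≡ toℕ x + m
  subMod≡m⇒antipodal x y s%≡m =
    [ (λ s%≡s → inj₁ (X≡Y+m s%≡s)) , (λ s%+2m≡s → inj₂ (Y≡X+m s%+2m≡s)) ]′
      (%-below-double s (2 * m) (+-mono-<-≤ (toℕ<n y) (m∸n≤m (2 * m) X)))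
    where
      open ≡-Reasoning
      X = toℕ x
      Y = toℕ y
      s = Y + (2 * m ∸ X)

      s+X≡Y+2m : s + X ≡ Y + 2 * m
      s+X≡Y+2m = trans (+-assoc Y _ X) (cong (Y +_) (m∸n+n≡m (<⇒≤ (toℕ<n x))))

      X≡Y+m : s % (2 * m) ≡ s → X ≡ Y + m
      X≡Y+m s%≡s = +-cancelʳ-≡ m X (Y + m) (begin
        X + m             ≡⟨ +-comm X m ⟩
        m + X             ≡⟨ cong (_+ X) (trans (sym s%≡m) s%≡s) ⟩
        s + X             ≡⟨ s+X≡Y+2m ⟩
        Y + 2 * m         ≡⟨ cong (λ t → Y + (m + t)) (+-identityʳ m) ⟩
        Y + (m + m)       ≡⟨ +-assoc Y m m ⟨
        Y + m + m         ∎)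

      Y≡X+m : s % (2 * m) + 2 * m ≡ s → Y ≡ X + m
      Y≡X+m s%+2m≡s = +-cancelʳ-≡ (2 * m) Y (X + m) (begin
        Y + 2 * m         ≡⟨ s+X≡Y+2m ⟨
        s + X             ≡⟨ cong (_+ X) (trans (sym s%+2m≡s) (cong (_+ 2 * m) s%≡m)) ⟩
        m + 2 * m + X     ≡⟨ +-assoc m (2 * m) X ⟩
        m + (2 * m + X)   ≡⟨ cong (m +_) (+-comm (2 * m) X) ⟩
        m + (X + 2 * m)   ≡⟨ +-assoc m X (2 * m) ⟨
        m + X + 2 * m     ≡⟨ cong (_+ 2 * m) (+-comm m X) ⟩
        X + m + 2 * m     ∎)

  module _ (a : Fin (2 * m) → Vec Bool m) (A : IsGrayCode m a) where
    open IsGrayCode A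

    hamming-antipodal : ∀ x y → toℕ x ≡ toℕ y + m ⊎ toℕ y ≡ toℕ x + m →
                        hamming (a x) (a y) ≡ m
    hamming-antipodal x y (inj₁ x≡y+m) rewrite compl y x x≡y+m =
      trans (hamming-comm (map not (a y)) (a y)) (hamming-not (a y))
    hamming-antipodal x y (inj₂ y≡x+m) rewrite compl x y y≡x+m = hamming-not (a x)

    wt2-≤-hamming : ∀ x y → wt2 m (subMod m y x) ≤ 2 * hamming (a x) (a y)
    wt2-≤-hamming x y = wt2-≤ m (subMod m y x) _ distinct-≤ antipodal-≤
      where
        distinct-≤ : subMod m y x ≢ 0 → m ≤ 2 * hamming (a x) (a y)
        distinct-≤ y-x≢0 = dist x y (λ x≡y → y-x≢0 (subst (λ z → subMod m z x ≡ 0) x≡y (subMod-self x)))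

        antipodal-≤ : subMod m y x ≡ m → 2 * m ≤ 2 * hamming (a x) (a y)
        antipodal-≤ y-x≡m =
          ≤-reflexive (cong (2 *_) (sym (hamming-antipodal x y (subMod≡m⇒antipodal x y y-x≡m))))

    dstar2-≤-hamming-gray : ∀ {n} (xs ys : Vec (Fin (2 * m)) n) →
                            dstar2 m xs ys ≤ 2 * hamming (gray a xs) (gray a ys)
    dstar2-≤-hamming-gray []       []       = z≤n
    dstar2-≤-hamming-gray (x ∷ xs) (y ∷ ys) = begin
      wt2 m (subMod m y x) + dstar2 m xs ys
        ≤⟨ +-mono-≤ (wt2-≤-hamming x y) (dstar2-≤-hamming-gray xs ys) ⟩
      2 * hamming (a x) (a y) + 2 * hamming (gray a xs) (gray a ys)
        ≡⟨ *-distribˡ-+ 2 (hamming (a x) (a y)) _ ⟨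
      2 * (hamming (a x) (a y) + hamming (gray a xs) (gray a ys))
        ≡⟨ cong (2 *_) (hamming-++ (a x) (a y) (gray a xs) (gray a ys)) ⟨
      2 * hamming (gray a (x ∷ xs)) (gray a (y ∷ ys)) ∎
      where open ≤-Reasoning

-- The Hadamard matrix and the bound 2 ≤ m only guarantee that a Gray code A exists;
-- given A itself the argument does not use them.
corollary1 : (m : ℕ) .{{_ : NonZero m}} → 2 ≤ m → HadamardExists m →
    (a : Fin (2 * m) → Vec Bool m) → IsGrayCode m a →
    (n M d : ℕ) (c : Fin M → Vec (Fin (2 * m)) n) → IsStarCode m n M d c →
    IsBinaryCode (n * m) M d (λ i → gray a (c i))
corollary1 m _ _ a A n M d c (c-injective , c-dstar) =
  (λ gray-c≡ → c-injective (gray-injective a (IsGrayCode.distinct A) gray-c≡)) ,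
  (λ i j i≢j → *-cancelˡ-≤ 2
     (≤-trans (c-dstar i j i≢j) (dstar2-≤-hamming-gray m a A (c i) (c j))))
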